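{- The relation $\mathit{exists}(x,n_1,\dots,n_S)$ on natural numbers, which holds iff there exists at least one ground term of $\Sigma$ of weight $x$ and contents $(n_1,\dots,n_S)$, is $\exists$-definable.
   Context: $\Sigma$ is a fixed finite signature with at least one constant and $w:\Sigma\to\mathbb{N}$ a fixed weight function ($w(a)>0$ for constants, at most one unary symbol of weight 0); the weight of a ground term is $|c|=w(c)$, $|g(t_1,\dots,t_n)|=w(g)+\sum|t_i|$. Fix an enumeration $g_1,\dots,g_S$ of $\Sigma$. The contents of a ground term $t$ is the tuple $(n_1,\dots,n_S)$ where $n_i$ is the number of occurrences of $g_i$ in $t$. A relation $R(\bar x)$ on natural numbers is $\exists$-definable if there is a quantifier-free... more precisely an existential formula $C(\bar x,\bar y)$ of Presburger arithmetic such that $R(\bar x)$ is equivalent to $\exists\bar y\,C(\bar x,\bar y)$. -}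

module Defs where

open import Data.Nat using (ℕ; zero; suc; _+_; _≤_; _<_)
open import Data.Fin using (Fin; _≟_)
open import Data.Vec using (Vec; []; _∷_; lookup; tabulate; _++_)
import Data.Vec.Functional as VF
open import Data.Product using (Σ; ∃; _×_; _,_)
open import Data.Sum using (_⊎_)
open import Data.Empty using (⊥)
open import Relation.Nullary using (¬_; yes; no)
open import Relation.Binary.PropositionalEquality using (_≡_)
open import Function.Bundles using (_⇔_)

-- Signatures with weights.  The symbols are g_0,…,g_{S-1} (Fin S);
-- the indexing by Fin S is the fixed enumeration of Σ.

record Signature : Set where
  field
    S      : ℕ
    arity  : Fin S → ℕ
    weight : Fin S → ℕ

record WellFormed (Σ' : Signature) : Set where
  open Signature Σ'
  field
    hasConstant   : ∃ λ (i : Fin S) → arity i ≡ 0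
    constPositive : ∀ (i : Fin S) → arity i ≡ 0 → 0 < weight i
    atMostOneZeroUnary : ∀ (i j : Fin S) →
      arity i ≡ 1 → weight i ≡ 0 → arity j ≡ 1 → weight j ≡ 0 → i ≡ j

sumFin : ∀ {n} → (Fin n → ℕ) → ℕ
sumFin f = VF.foldr _+_ 0 f

module Terms (Σ' : Signature) where
  open Signature Σ'

  data Term : Set where
    node : (i : Fin S) → (Fin (arity i) → Term) → Term

  ∣_∣ : Term → ℕ
  ∣ node i ts ∣ = weight i + sumFin (λ j → ∣ ts j ∣)

  occ : Fin S → Term → ℕ
  occ k (node i ts) with i ≟ k
  ... | yes _ = suc (sumFin (λ j → occ k (ts j)))
  ... | no  _ = sumFin (λ j → occ k (ts j))

  contents : Term → Vec ℕ S
  contents t = tabulate (λ k → occ k t)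

  existsRel : Vec ℕ (suc S) → Set
  existsRel (x ∷ ns) = Σ Term λ t → (∣ t ∣ ≡ x) × (contents t ≡ ns)

data PTerm (n : ℕ) : Set where
  var  : Fin n → PTerm n
  zer  : PTerm n
  one  : PTerm n
  _⊕_  : PTerm n → PTerm n → PTerm n

data QF (n : ℕ) : Set where
  _≐_  : PTerm n → PTerm n → QF n
  _≼_  : PTerm n → PTerm n → QF n
  ¬'_  : QF n → QF n
  _∧'_ : QF n → QF n → QF n
  _∨'_ : QF n → QF n → QF n

evalT : ∀ {n} → Vec ℕ n → PTerm n → ℕ
evalT ρ (var i) = lookup ρ i
evalT ρ zer = 0
evalT ρ one = 1
evalT ρ (s ⊕ t) = evalT ρ s + evalT ρ t

⟦_⟧ : ∀ {n} → QF n → Vec ℕ n → Set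
⟦ s ≐ t ⟧ ρ = evalT ρ s ≡ evalT ρ t
⟦ s ≼ t ⟧ ρ = evalT ρ s ≤ evalT ρ t
⟦ ¬' φ ⟧ ρ = ¬ ⟦ φ ⟧ ρ
⟦ φ ∧' ψ ⟧ ρ = ⟦ φ ⟧ ρ × ⟦ ψ ⟧ ρ
⟦ φ ∨' ψ ⟧ ρ = ⟦ φ ⟧ ρ ⊎ ⟦ ψ ⟧ ρ

ExistsDefinable : ∀ {k} → (Vec ℕ k → Set) → Set
ExistsDefinable {k} R =
  Σ ℕ λ m → Σ (QF (k + m)) λ C →
    ∀ (xs : Vec ℕ k) → R xs ⇔ (Σ (Vec ℕ m) λ ys → ⟦ C ⟧ (xs ++ ys))

{-# OPTIONS --safe #-}
-- A term with contents n has weight Σ wᵢ nᵢ, and counting every node once as the root or as a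
-- child of its parent gives Σ nᵢ = 1 + Σ arity(gᵢ) nᵢ.  Conversely, any counts c with
-- Σ c = k + Σ arity · c (k ≥ 1) are the contents of a forest of k trees: take one symbol of
-- positive count as the root of the first tree and build the remaining forest, whose number
-- of trees is arity(g) + k - 1, recursively.  Hence exists is defined by two linear
-- equations, and no existential witnesses are needed at all.
module Submission where

open import Defs

open import Data.Nat using (ℕ; zero; suc; _+_; _*_; _∸_; _≤_; _<_; _<?_; z≤n; z<s)
open import Data.Nat.Properties
  using (+-*-semiring; +-assoc; +-comm; +-identityʳ; *-zeroʳ; *-identityʳ; *-distribˡ-+;
         suc-injective; m+n≡0⇒m≡0; m+n≡0⇒n≡0; n≤0⇒n≡0; ≮⇒≥; >⇒≢; m+[n∸m]≡n)
open import Data.Fin using (Fin; zero; suc; _↑ˡ_; _≟_)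
open import Data.Fin.Properties using (any?)
open import Data.Vec using (Vec; []; _∷_; lookup; _++_)
open import Data.Vec.Properties using (lookup-++ˡ; lookup∘tabulate; tabulate∘lookup; tabulate-cong)
import Data.Vec.Functional as VF
open import Data.Product using (∃; _×_; _,_)
open import Function.Base using (_∘_)
open import Function.Bundles using (_⇔_; mk⇔)
import Function.Properties.Equivalence as ⇔
open import Relation.Nullary using (yes; no; contradiction)
open import Relation.Nullary.Decidable using (_×-dec_)
open import Relation.Binary.PropositionalEquality
open import Algebra.Properties.Semiring.Sum +-*-semiring
  using (sum; sum-cong-≗; sum-replicate-zero; ∑-distrib-+; ∑-comm; *-distribˡ-sum)

infix 8 _·_

_·_ : ∀ {n} → (Fin n → ℕ) → (Fin n → ℕ) → ℕ
f · c = sum (λ k → f k * c k)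

sum-zero : ∀ {n} (c : Fin n → ℕ) → (∀ k → c k ≡ 0) → sum c ≡ 0
sum-zero {n} c c≗0 = trans (sum-cong-≗ c≗0) (sum-replicate-zero n)

sum-1 : ∀ n → sum {n} (λ _ → 1) ≡ n
sum-1 zero    = refl
sum-1 (suc n) = cong suc (sum-1 n)

sum≡0⇒≡0 : ∀ {n} (c : Fin n → ℕ) → sum c ≡ 0 → ∀ k → c k ≡ 0
sum≡0⇒≡0 c sum≡0 zero    = m+n≡0⇒m≡0 (c zero) sum≡0
sum≡0⇒≡0 c sum≡0 (suc k) = sum≡0⇒≡0 (VF.tail c) (m+n≡0⇒n≡0 (c zero) sum≡0) k

sum>0⇒∃>0 : ∀ {n} (c : Fin n → ℕ) → 0 < sum c → ∃ λ k → 0 < c k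
sum>0⇒∃>0 c sum>0 with any? (λ k → 0 <? c k)
... | yes found = found
... | no  none  = contradiction (sum-zero c λ k → n≤0⇒n≡0 (≮⇒≥ (λ ck>0 → none (k , ck>0))))
                                (>⇒≢ sum>0)

sum-take-drop : ∀ m {n} (f : Fin (m + n) → ℕ) → sum (VF.take m f) + sum (VF.drop m f) ≡ sum f
sum-take-drop zero    f = refl
sum-take-drop (suc m) f =
  trans (+-assoc (f zero) _ _) (cong (f zero +_) (sum-take-drop m (VF.tail f)))

·-congʳ : ∀ {n} (f : Fin n → ℕ) {c d : Fin n → ℕ} → (∀ k → c k ≡ d k) → f · c ≡ f · d
·-congʳ f c≗d = sum-cong-≗ (λ k → cong (f k *_) (c≗d k))

·-distribˡ-+ : ∀ {n} (f c d : Fin n → ℕ) → f · (λ k → c k + d k) ≡ f · c + f · d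
·-distribˡ-+ f c d = trans (sum-cong-≗ (λ k → *-distribˡ-+ (f k) (c k) (d k)))
                           (∑-distrib-+ (λ k → f k * c k) (λ k → f k * d k))

·-distribˡ-sum : ∀ {m n} (f : Fin n → ℕ) (c : Fin m → Fin n → ℕ) →
                 f · (λ k → sum (λ i → c i k)) ≡ sum (λ i → f · c i)
·-distribˡ-sum f c =
  trans (sum-cong-≗ (λ k → *-distribˡ-sum (f k) (λ i → c i k))) (∑-comm (λ k i → f k * c i k))

δ : ∀ {n} → Fin n → Fin n → ℕ
δ zero    zero    = 1
δ zero    (suc _) = 0
δ (suc _) zero    = 0
δ (suc i) (suc k) = δ i k

δ-refl : ∀ {n} (i : Fin n) → δ i i ≡ 1
δ-refl zero    = refl
δ-refl (suc i) = δ-refl i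

δ-≢ : ∀ {n} {i k : Fin n} → i ≢ k → δ i k ≡ 0
δ-≢ {i = zero}  {zero}  i≢k = contradiction refl i≢k
δ-≢ {i = zero}  {suc k} _   = refl
δ-≢ {i = suc i} {zero}  _   = refl
δ-≢ {i = suc i} {suc k} i≢k = δ-≢ (i≢k ∘ cong suc)

sum-δ : ∀ {n} (i : Fin n) → sum (δ i) ≡ 1
sum-δ {suc n} zero = cong suc (sum-zero {n} _ (λ _ → refl))
sum-δ (suc i)      = sum-δ i

·-δ : ∀ {n} (f : Fin n → ℕ) (i : Fin n) → f · δ i ≡ f i
·-δ f zero    = trans (cong₂ _+_ (*-identityʳ (f zero))
                                 (sum-zero (λ k → f (suc k) * 0) (λ k → *-zeroʳ (f (suc k)))))
                      (+-identityʳ (f zero))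
·-δ f (suc i) = trans (cong (_+ VF.tail f · δ i) (*-zeroʳ (f zero))) (·-δ (VF.tail f) i)

δ≤ : ∀ {n} (c : Fin n → ℕ) {g : Fin n} → 0 < c g → ∀ k → δ g k ≤ c k
δ≤ c {zero}  c₀>0 zero    = c₀>0
δ≤ c {zero}  _    (suc k) = z≤n
δ≤ c {suc g} _    zero    = z≤n
δ≤ c {suc g} cg>0 (suc k) = δ≤ (VF.tail c) cg>0 k

_⊖_ : ∀ {n} → (Fin n → ℕ) → Fin n → Fin n → ℕ
(c ⊖ g) k = c k ∸ δ g k

⊖-split : ∀ {n} (c : Fin n → ℕ) {g} → 0 < c g → ∀ k → c k ≡ δ g k + (c ⊖ g) k
⊖-split c cg>0 k = sym (m+[n∸m]≡n (δ≤ c cg>0 k))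

sum-⊖ : ∀ {n} (c : Fin n → ℕ) {g} → 0 < c g → sum c ≡ suc (sum (c ⊖ g))
sum-⊖ c {g} cg>0 = begin
  sum c                           ≡⟨ sum-cong-≗ (⊖-split c cg>0) ⟩
  sum (λ k → δ g k + (c ⊖ g) k)   ≡⟨ ∑-distrib-+ (δ g) (c ⊖ g) ⟩
  sum (δ g) + sum (c ⊖ g)         ≡⟨ cong (_+ sum (c ⊖ g)) (sum-δ g) ⟩
  suc (sum (c ⊖ g))               ∎
  where open ≡-Reasoning

·-⊖ : ∀ {n} (f c : Fin n → ℕ) {g} → 0 < c g → f · c ≡ f g + f · (c ⊖ g)
·-⊖ f c {g} cg>0 = begin
  f · c                           ≡⟨ ·-congʳ f (⊖-split c cg>0) ⟩
  f · (λ k → δ g k + (c ⊖ g) k)   ≡⟨ ·-distribˡ-+ f (δ g) (c ⊖ g) ⟩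
  f · δ g + f · (c ⊖ g)           ≡⟨ cong (_+ f · (c ⊖ g)) (·-δ f g) ⟩
  f g + f · (c ⊖ g)               ∎
  where open ≡-Reasoning

infixl 7 _⊛_

_⊛_ : ∀ {n} → ℕ → PTerm n → PTerm n
zero  ⊛ t = zer
suc a ⊛ t = t ⊕ (a ⊛ t)

∑ᵀ : ∀ {m n} → (Fin m → PTerm n) → PTerm n
∑ᵀ = VF.foldr _⊕_ zer

linear : ∀ {m n} → (Fin m → ℕ) → (Fin m → Fin n) → PTerm n
linear a x = ∑ᵀ (λ i → a i ⊛ var (x i))

evalT-⊛ : ∀ {n} (ρ : Vec ℕ n) a t → evalT ρ (a ⊛ t) ≡ a * evalT ρ t
evalT-⊛ ρ zero    t = refl
evalT-⊛ ρ (suc a) t = cong (evalT ρ t +_) (evalT-⊛ ρ a t)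

evalT-∑ᵀ : ∀ {m n} (ρ : Vec ℕ n) (ts : Fin m → PTerm n) → evalT ρ (∑ᵀ ts) ≡ sum (evalT ρ ∘ ts)
evalT-∑ᵀ {zero}  ρ ts = refl
evalT-∑ᵀ {suc m} ρ ts = cong (evalT ρ (ts zero) +_) (evalT-∑ᵀ ρ (VF.tail ts))

evalT-linear : ∀ {m n} (ρ : Vec ℕ n) a (x : Fin m → Fin n) →
               evalT ρ (linear a x) ≡ a · (lookup ρ ∘ x)
evalT-linear ρ a x = trans (evalT-∑ᵀ ρ (λ i → a i ⊛ var (x i)))
                           (sum-cong-≗ (λ i → evalT-⊛ ρ (a i) (var (x i))))

qfDefinable⇒existsDefinable : ∀ {k} {R : Vec ℕ k → Set} (C : QF (k + 0)) →
                              (∀ xs → R xs ⇔ ⟦ C ⟧ (xs ++ [])) → ExistsDefinable R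
qfDefinable⇒existsDefinable C R⇔C = 0 , C , λ xs →
  ⇔.trans (R⇔C xs) (mk⇔ ([] ,_) λ { ([] , Cxs) → Cxs })

module TermCounting (Σ' : Signature) where
  open Signature Σ'
  open Terms Σ'

  occs : Term → Fin S → ℕ
  occs t k = occ k t

  forestOccs : ∀ {m} → (Fin m → Term) → Fin S → ℕ
  forestOccs ts k = sum (λ j → occ k (ts j))

  occs-node : ∀ i ts k → occs (node i ts) k ≡ δ i k + forestOccs ts k
  occs-node i ts k with i ≟ k
  ... | yes refl = cong (_+ forestOccs ts k) (sym (δ-refl i))
  ... | no  i≢k  = cong (_+ forestOccs ts k) (sym (δ-≢ i≢k))

  Balanced : ℕ → (Fin S → ℕ) → Set
  Balanced m c = sum c ≡ m + arity · c

  ·-occs-node : ∀ f i ts → f · occs (node i ts) ≡ f i + sum (λ j → f · occs (ts j))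
  ·-occs-node f i ts = begin
    f · occs (node i ts)                 ≡⟨ ·-congʳ f (occs-node i ts) ⟩
    f · (λ k → δ i k + forestOccs ts k)  ≡⟨ ·-distribˡ-+ f (δ i) (forestOccs ts) ⟩
    f · δ i + f · forestOccs ts          ≡⟨ cong₂ _+_ (·-δ f i) (·-distribˡ-sum f (occs ∘ ts)) ⟩
    f i + sum (λ j → f · occs (ts j))    ∎
    where open ≡-Reasoning

  ∣∣≡weight·occs : ∀ t → ∣ t ∣ ≡ weight · occs t
  ∣∣≡weight·occs (node i ts) = begin
    weight i + sum (λ j → ∣ ts j ∣)              ≡⟨ cong (weight i +_) (sum-cong-≗ (∣∣≡weight·occs ∘ ts)) ⟩
    weight i + sum (λ j → weight · occs (ts j))  ≡⟨ ·-occs-node weight i ts ⟨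
    weight · occs (node i ts)                    ∎
    where open ≡-Reasoning

  balanced-occs : ∀ t → Balanced 1 (occs t)
  balanced-occs (node i ts) = begin
    sum (occs (node i ts))                     ≡⟨ sum-cong-≗ (occs-node i ts) ⟩
    sum (λ k → δ i k + forestOccs ts k)        ≡⟨ ∑-distrib-+ (δ i) (forestOccs ts) ⟩
    sum (δ i) + sum (forestOccs ts)            ≡⟨ cong₂ _+_ (sum-δ i) (∑-comm (λ k j → occ k (ts j))) ⟩
    suc (sum (λ j → sum (occs (ts j))))        ≡⟨ cong suc (sum-cong-≗ (balanced-occs ∘ ts)) ⟩
    suc (sum (λ j → 1 + arity · occs (ts j)))  ≡⟨ cong suc (∑-distrib-+ (λ _ → 1) (λ j → arity · occs (ts j))) ⟩
    suc (sum {arity i} (λ _ → 1) + Σchildren)  ≡⟨ cong (λ n → suc (n + Σchildren)) (sum-1 (arity i)) ⟩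
    suc (arity i + Σchildren)                  ≡⟨ cong suc (·-occs-node arity i ts) ⟨
    suc (arity · occs (node i ts))             ∎
    where
    open ≡-Reasoning
    Σchildren : ℕ
    Σchildren = sum (λ j → arity · occs (ts j))

  graft : ∀ g {m} → (Fin (arity g + m) → Term) → Fin (suc m) → Term
  graft g ts = node g (VF.take (arity g) ts) VF.∷ VF.drop (arity g) ts

  forestOccs-graft : ∀ g {m} (ts : Fin (arity g + m) → Term) k →
                     forestOccs (graft g ts) k ≡ δ g k + forestOccs ts k
  forestOccs-graft g ts k = begin
    occ k (node g (VF.take (arity g) ts)) + forestOccs (VF.drop (arity g) ts) k
      ≡⟨ cong (_+ forestOccs (VF.drop (arity g) ts) k) (occs-node g (VF.take (arity g) ts) k) ⟩
    δ g k + forestOccs (VF.take (arity g) ts) k + forestOccs (VF.drop (arity g) ts) k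
      ≡⟨ +-assoc (δ g k) _ _ ⟩
    δ g k + (forestOccs (VF.take (arity g) ts) k + forestOccs (VF.drop (arity g) ts) k)
      ≡⟨ cong (δ g k +_) (sum-take-drop (arity g) (λ j → occ k (ts j))) ⟩
    δ g k + forestOccs ts k
      ∎
    where open ≡-Reasoning

  -- Preferring a root of positive arity ensures that the remaining forest has no trees only
  -- when no symbols of positive arity are left.
  chooseRoot : ∀ (c : Fin S → ℕ) → 0 < sum c → ∃ λ g → 0 < c g × (arity g ≡ 0 → arity · c ≡ 0)
  chooseRoot c sum>0 with any? (λ g → (0 <? c g) ×-dec (0 <? arity g))
  ... | yes (g , cg>0 , ag>0) = g , cg>0 , λ ag≡0 → contradiction ag≡0 (>⇒≢ ag>0)
  ... | no  none              = let g , cg>0 = sum>0⇒∃>0 c sum>0 in g , cg>0 , λ _ → sum-zero _ noActive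
    where
    noActive : ∀ k → arity k * c k ≡ 0
    noActive k with 0 <? c k
    ... | yes ck>0 = cong (_* c k) (n≤0⇒n≡0 (≮⇒≥ (λ ak>0 → none (k , ck>0 , ak>0))))
    ... | no  ck≯0 = trans (cong (arity k *_) (n≤0⇒n≡0 (≮⇒≥ ck≯0))) (*-zeroʳ (arity k))

  balanced-⊖ : ∀ {m} (c : Fin S → ℕ) {g} → 0 < c g → Balanced (suc m) c → Balanced (arity g + m) (c ⊖ g)
  balanced-⊖ {m} c {g} cg>0 bal = suc-injective (begin
    suc (sum (c ⊖ g))                       ≡⟨ sum-⊖ c cg>0 ⟨
    sum c                                   ≡⟨ bal ⟩
    suc m + arity · c                       ≡⟨ cong (suc m +_) (·-⊖ arity c cg>0) ⟩
    suc (m + (arity g + arity · (c ⊖ g)))   ≡⟨ cong suc (+-assoc m (arity g) _) ⟨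
    suc (m + arity g + arity · (c ⊖ g))     ≡⟨ cong (λ n → suc (n + arity · (c ⊖ g))) (+-comm m (arity g)) ⟩
    suc (arity g + m + arity · (c ⊖ g))     ∎)
    where open ≡-Reasoning

  noTrees-⊖ : ∀ {m} (c : Fin S → ℕ) {g} → 0 < c g → (arity g ≡ 0 → arity · c ≡ 0) →
              arity g + m ≡ 0 → arity · (c ⊖ g) ≡ 0
  noTrees-⊖ c {g} cg>0 leaf⇒ ag+m≡0 = m+n≡0⇒n≡0 (arity g)
    (trans (sym (·-⊖ arity c cg>0)) (leaf⇒ (m+n≡0⇒m≡0 (arity g) ag+m≡0)))

  -- Given balance, the side condition says that a forest without trees has no symbols.
  forest : ∀ N {m} (c : Fin S → ℕ) → sum c ≡ N → Balanced m c → (m ≡ 0 → arity · c ≡ 0) →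
           ∃ λ (ts : Fin m → Term) → ∀ k → forestOccs ts k ≡ c k
  forest zero    {zero}  c c≡0 _   _     = (λ ()) , λ k → sym (sum≡0⇒≡0 c c≡0 k)
  forest zero    {suc m} c c≡0 bal _     = contradiction (trans (sym c≡0) bal) λ ()
  forest (suc N) {zero}  c c≡N bal empty = contradiction (trans (sym c≡N) (trans bal (empty refl))) λ ()
  forest (suc N) {suc m} c c≡N bal _
    with g , cg>0 , leaf⇒ ← chooseRoot c (subst (0 <_) (sym c≡N) z<s)
    with ts , ts≗c⊖g ← forest N (c ⊖ g) (suc-injective (trans (sym (sum-⊖ c cg>0)) c≡N))
                                (balanced-⊖ c cg>0 bal) (noTrees-⊖ c cg>0 leaf⇒)
    = graft g ts , λ k → begin
        forestOccs (graft g ts) k  ≡⟨ forestOccs-graft g ts k ⟩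
        δ g k + forestOccs ts k   ≡⟨ cong (δ g k +_) (ts≗c⊖g k) ⟩
        δ g k + (c ⊖ g) k         ≡⟨ ⊖-split c cg>0 k ⟨
        c k                        ∎
    where open ≡-Reasoning

  balanced⇒term : (c : Fin S → ℕ) → Balanced 1 c → ∃ λ t → ∀ k → occs t k ≡ c k
  balanced⇒term c bal =
    let ts , ts≗c = forest (sum c) c refl bal (λ ())
    in ts zero , λ k → trans (sym (+-identityʳ _)) (ts≗c k)

  existsRel⇔ : ∀ x ns → existsRel (x ∷ ns) ⇔ (x ≡ weight · lookup ns × Balanced 1 (lookup ns))
  existsRel⇔ x ns = mk⇔ to from
    where
    to : existsRel (x ∷ ns) → x ≡ weight · lookup ns × Balanced 1 (lookup ns)
    to (t , refl , refl) =
      trans (∣∣≡weight·occs t) (sym (·-congʳ weight lookup≗occs)) ,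
      trans (sum-cong-≗ lookup≗occs) (trans (balanced-occs t) (cong suc (sym (·-congʳ arity lookup≗occs))))
      where
      lookup≗occs : ∀ k → lookup (contents t) k ≡ occs t k
      lookup≗occs = lookup∘tabulate (occs t)
    from : x ≡ weight · lookup ns × Balanced 1 (lookup ns) → existsRel (x ∷ ns)
    from (x≡ , bal) =
      let t , occs≗ = balanced⇒term (lookup ns) bal
      in t , trans (∣∣≡weight·occs t) (trans (·-congʳ weight occs≗) (sym x≡)) ,
             trans (tabulate-cong occs≗) (tabulate∘lookup ns)

  nᵢ : Fin S → Fin (suc S + 0)
  nᵢ i = suc (i ↑ˡ 0)

  existsFormula : QF (suc S + 0)
  existsFormula = (var zero ≐ linear weight nᵢ) ∧' (∑ᵀ (var ∘ nᵢ) ≐ (one ⊕ linear arity nᵢ))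

  ⟦existsFormula⟧ : ∀ x ns → ⟦ existsFormula ⟧ ((x ∷ ns) ++ []) ⇔
                    (x ≡ weight · lookup ns × Balanced 1 (lookup ns))
  ⟦existsFormula⟧ x ns = mk⇔
    (λ (x≡ , bal) → trans x≡ w , trans (sym s) (trans bal (cong suc a)))
    (λ (x≡ , bal) → trans x≡ (sym w) , trans s (trans bal (cong suc (sym a))))
    where
    ρ : Vec ℕ (suc S + 0)
    ρ = (x ∷ ns) ++ []
    lookup-nᵢ : ∀ i → lookup ρ (nᵢ i) ≡ lookup ns i
    lookup-nᵢ = lookup-++ˡ ns []
    w : evalT ρ (linear weight nᵢ) ≡ weight · lookup ns
    w = trans (evalT-linear ρ weight nᵢ) (·-congʳ weight lookup-nᵢ)
    a : evalT ρ (linear arity nᵢ) ≡ arity · lookup ns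
    a = trans (evalT-linear ρ arity nᵢ) (·-congʳ arity lookup-nᵢ)
    s : evalT ρ (∑ᵀ (var ∘ nᵢ)) ≡ sum (lookup ns)
    s = trans (evalT-∑ᵀ ρ (var ∘ nᵢ)) (sum-cong-≗ lookup-nᵢ)

lemma12 : (Σ' : Signature) → WellFormed Σ' → ExistsDefinable (Terms.existsRel Σ')
lemma12 Σ' _ = qfDefinable⇒existsDefinable existsFormula
  λ { (x ∷ ns) → ⇔.trans (existsRel⇔ x ns) (⇔.sym (⟦existsFormula⟧ x ns)) }
  where open TermCounting Σ'
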